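{- Let $k\ge1$ and let $f$ and $g$ be formal expressions in $2k$ set variables built using only the binary operations $\cap$ and $\cup$. Then $f(A_1^{(k)},\dots,A_k^{(k)},A_1^{c(k)},\dots,A_k^{c(k)})\subseteq g(A_1^{(k)},\dots,A_k^{(k)},A_1^{c(k)},\dots,A_k^{c(k)})$ if and only if $f(A_1,\dots,A_k,A_1^c,\dots,A_k^c)\subseteq g(A_1,\dots,A_k,A_1^c,\dots,A_k^c)$.
   Context: For $1\le i\le k$: $A_i^{(k)}=\{\sum_{j=1}^k l_j2^{j-1}: l_i=1,\ l_j\in\{0,1\}\}$ and $A_i^{c(k)}=\{\sum_{j=1}^k l_j2^{j-1}: l_i=0,\ l_j\in\{0,1\}\}$ (subsets of $\{0,1,\dots,2^k-1\}$); $A_i\subseteq\mathbb{N}$ is the set of natural numbers whose binary digit in position $i$ (coefficient of $2^{i-1}$) equals $1$, and $A_i^c\subseteq\mathbb{N}$ is the set of natural numbers whose binary digit in position $i$ equals $0$. -}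

module Defs where

open import Level using (0ℓ)
open import Data.Nat using (ℕ; zero; suc; _+_; _*_; _^_; _<_; _%_; _/_)
open import Data.Fin using (Fin; toℕ; splitAt)
open import Data.Sum using (_⊎_; inj₁; inj₂)
open import Data.Product using (_×_)
open import Relation.Binary.PropositionalEquality using (_≡_)
open import Relation.Unary using (Pred; _⊆_; _∩_; _∪_)

data Expr (n : ℕ) : Set where
  var  : Fin n → Expr n
  _∩ₑ_ : Expr n → Expr n → Expr n
  _∪ₑ_ : Expr n → Expr n → Expr n

eval : {n : ℕ} → Expr n → (Fin n → Pred ℕ 0ℓ) → Pred ℕ 0ℓ
eval (var x)    σ = σ x
eval (e ∩ₑ e′) σ = eval e σ ∩ eval e′ σ
eval (e ∪ₑ e′) σ = eval e σ ∪ eval e′ σ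

-- Binary digit of m at position j+1 (coefficient of 2^j), for 0-based j;
-- equals (m / 2^j) % 2.
digit : ℕ → ℕ → ℕ
digit m zero    = m % 2
digit m (suc j) = digit (m / 2) j

-- A_{i+1} and A_{i+1}^c as subsets of ℕ (i : Fin k is the 0-based index).
A : {k : ℕ} → Fin k → Pred ℕ 0ℓ
A i m = digit m (toℕ i) ≡ 1

Ac : {k : ℕ} → Fin k → Pred ℕ 0ℓ
Ac i m = digit m (toℕ i) ≡ 0

Ak : (k : ℕ) → Fin k → Pred ℕ 0ℓ
Ak k i m = m < 2 ^ k × digit m (toℕ i) ≡ 1

Ack : (k : ℕ) → Fin k → Pred ℕ 0ℓ
Ack k i m = m < 2 ^ k × digit m (toℕ i) ≡ 0

infAssign : (k : ℕ) → Fin (k + k) → Pred ℕ 0ℓ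
infAssign k x with splitAt k x
... | inj₁ i = A i
... | inj₂ i = Ac i

finAssign : (k : ℕ) → Fin (k + k) → Pred ℕ 0ℓ
finAssign k x with splitAt k x
... | inj₁ i = Ak k i
... | inj₂ i = Ack k i

{-# OPTIONS --safe #-}
module Submission where

-- Membership of m in A_i or A_i^c depends only on the i-th binary digit of m,
-- and for i ≤ k that digit is the same for m and for m mod 2^k. Since an
-- ∩/∪-expression is evaluated pointwise, m lies in f(A, A^c) exactly when
-- m mod 2^k does; and because intersecting every variable with {0,…,2^k-1}
-- commutes with ∩ and ∪, f(A^{(k)}, A^{c(k)}) = f(A, A^c) ∩ {0,…,2^k-1}.

open import Defs
open import Level using (0ℓ)
open import Data.Nat using (ℕ; zero; suc; _+_; _*_; _^_; _<_; _≥_; _%_; _/_; s≤s; NonZero)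
open import Data.Nat.Properties using (m^n≢0; m*n≢0; *-comm)
open import Data.Nat.DivMod using (%-congʳ; m∣n⇒o%n%m≡o%m; m%[n*o]/o≡m/o%n; m%n<n)
open import Data.Nat.Divisibility using (divides)
open import Data.Fin using (Fin; splitAt)
open import Data.Fin.Properties using (toℕ<n)
open import Data.Sum using (inj₁; inj₂)
open import Data.Product using (_×_; _,_; proj₁; proj₂)
open import Relation.Unary using (Pred; _⊆_; _∩_; _≐_)
open import Relation.Unary.Properties using (≐-trans)
open import Relation.Binary.PropositionalEquality using (_≡_; trans; sym; cong)

module _ {n : ℕ} where

  eval-transport : (e : Expr n) {σ τ : Fin n → Pred ℕ 0ℓ} {a b : ℕ} →
                   (∀ x → σ x a → τ x b) → eval e σ a → eval e τ b
  eval-transport (var x)    h p        = h x p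
  eval-transport (e ∩ₑ e′) h (p , q)  = eval-transport e h p , eval-transport e′ h q
  eval-transport (e ∪ₑ e′) h (inj₁ p) = inj₁ (eval-transport e h p)
  eval-transport (e ∪ₑ e′) h (inj₂ p) = inj₂ (eval-transport e′ h p)

  eval-⊆ : (e : Expr n) {σ : Fin n → Pred ℕ 0ℓ} {P : Pred ℕ 0ℓ} →
           (∀ x → σ x ⊆ P) → eval e σ ⊆ P
  eval-⊆ (var x)    h p        = h x p
  eval-⊆ (e ∩ₑ _)   h (p , _)  = eval-⊆ e h p
  eval-⊆ (e ∪ₑ _)   h (inj₁ p) = eval-⊆ e h p
  eval-⊆ (_ ∪ₑ e′) h (inj₂ p) = eval-⊆ e′ h p

  eval-∩ˡ : (e : Expr n) (P : Pred ℕ 0ℓ) (σ : Fin n → Pred ℕ 0ℓ) →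
            eval e (λ x → P ∩ σ x) ≐ P ∩ eval e σ
  eval-∩ˡ e P σ =
      (λ p → eval-⊆ e (λ _ → proj₁) p , eval-transport e (λ _ → proj₂) p)
    , (λ (q , p) → eval-transport e (λ _ → q ,_) p)

  eval-cong : (e : Expr n) {σ τ : Fin n → Pred ℕ 0ℓ} →
              (∀ x → σ x ≐ τ x) → eval e σ ≐ eval e τ
  eval-cong e h = eval-transport e (λ x → proj₁ (h x)) , eval-transport e (λ x → proj₂ (h x))

lowBits : ℕ → ℕ → ℕ
lowBits k m = _%_ m (2 ^ k) {{m^n≢0 2 k}}

lowBits<2^k : (k m : ℕ) → lowBits k m < 2 ^ k
lowBits<2^k k m = m%n<n m (2 ^ k) {{m^n≢0 2 k}}

lowBits-suc-/2 : (k m : ℕ) → lowBits (suc k) m / 2 ≡ lowBits k (m / 2)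
lowBits-suc-/2 k m = trans
  (cong (_/ 2) (%-congʳ {{m^n≢0 2 (suc k)}} {{2^k*2≢0}} (*-comm 2 (2 ^ k))))
  (m%[n*o]/o≡m/o%n m (2 ^ k) 2 {{m^n≢0 2 k}} {{_}} {{2^k*2≢0}})
  where
  2^k*2≢0 : NonZero (2 ^ k * 2)
  2^k*2≢0 = m*n≢0 (2 ^ k) 2 {{m^n≢0 2 k}}

digit-lowBits : {k j : ℕ} (m : ℕ) → j < k → digit (lowBits k m) j ≡ digit m j
digit-lowBits {suc k} {zero}  m _         =
  m∣n⇒o%n%m≡o%m 2 (2 ^ suc k) m {{_}} {{m^n≢0 2 (suc k)}} (divides (2 ^ k) (*-comm 2 (2 ^ k)))
digit-lowBits {suc k} {suc j} m (s≤s j<k) =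
  trans (cong (λ r → digit r j) (lowBits-suc-/2 k m)) (digit-lowBits (m / 2) j<k)

infAssign-digits : (k : ℕ) (x : Fin (k + k)) {m m′ : ℕ} →
                   (∀ {j} → j < k → digit m j ≡ digit m′ j) → infAssign k x m → infAssign k x m′
infAssign-digits k x same with splitAt k x
... | inj₁ i = trans (sym (same (toℕ<n i)))
... | inj₂ i = trans (sym (same (toℕ<n i)))

finAssign≐ : (k : ℕ) (x : Fin (k + k)) → finAssign k x ≐ (_< 2 ^ k) ∩ infAssign k x
finAssign≐ k x with splitAt k x
... | inj₁ _ = (λ p → p) , (λ p → p)
... | inj₂ _ = (λ p → p) , (λ p → p)

eval-finAssign : (k : ℕ) (e : Expr (k + k)) → eval e (finAssign k) ≐ (_< 2 ^ k) ∩ eval e (infAssign k)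
eval-finAssign k e = ≐-trans (eval-cong e (finAssign≐ k)) (eval-∩ˡ e (_< 2 ^ k) (infAssign k))

module _ (k : ℕ) (e : Expr (k + k)) {m : ℕ} where

  eval-infAssign-lowBits⁺ : eval e (infAssign k) m → eval e (infAssign k) (lowBits k m)
  eval-infAssign-lowBits⁺ =
    eval-transport e (λ x → infAssign-digits k x (λ j<k → sym (digit-lowBits m j<k)))

  eval-infAssign-lowBits⁻ : eval e (infAssign k) (lowBits k m) → eval e (infAssign k) m
  eval-infAssign-lowBits⁻ =
    eval-transport e (λ x → infAssign-digits k x (digit-lowBits m))

proposition4p13 : (k : ℕ) → k ≥ 1 → (f g : Expr (k + k)) →
    ((eval f (finAssign k) ⊆ eval g (finAssign k)) → (eval f (infAssign k) ⊆ eval g (infAssign k)))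
    × ((eval f (infAssign k) ⊆ eval g (infAssign k)) → (eval f (finAssign k) ⊆ eval g (finAssign k)))
proposition4p13 k _ f g = fin⊆⇒inf⊆ , inf⊆⇒fin⊆
  where
  fin⊆⇒inf⊆ : eval f (finAssign k) ⊆ eval g (finAssign k) → eval f (infAssign k) ⊆ eval g (infAssign k)
  fin⊆⇒inf⊆ f⊆g {m} m∈f = eval-infAssign-lowBits⁻ k g (proj₂ (proj₁ (eval-finAssign k g) low∈g))
    where
    low∈g : eval g (finAssign k) (lowBits k m)
    low∈g = f⊆g (proj₂ (eval-finAssign k f) (lowBits<2^k k m , eval-infAssign-lowBits⁺ k f m∈f))

  inf⊆⇒fin⊆ : eval f (infAssign k) ⊆ eval g (infAssign k) → eval f (finAssign k) ⊆ eval g (finAssign k)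
  inf⊆⇒fin⊆ f⊆g m∈f with proj₁ (eval-finAssign k f) m∈f
  ... | m<2^k , m∈f∞ = proj₂ (eval-finAssign k g) (m<2^k , f⊆g m∈f∞)
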